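{- Let $R$ be a commutative ring with unity, $P\in R[x_1,\dots,x_n]$, and let $J=\{\alpha_1,\dots,\alpha_k\}$ be a Rado set for $P$. Then for every $j\in\{1,\dots,k\}$ the $(k-1)\times n$ integer matrix $M_j(J)$ whose rows are the vectors $\alpha_i-\alpha_j$ for $i\in\{1,\dots,k\}\setminus\{j\}$ satisfies the columns condition.
   Context: $\operatorname{supp}(P)\subseteq\mathbb{N}_0^n$ is the finite set of exponent vectors of monomials of $P$ with nonzero coefficient. A rational matrix with columns $C_1,\dots,C_n$ satisfies the columns condition if there is a partition $I_0,\dots,I_r$ of $\{1,\dots,n\}$ into nonempty sets with $\sum_{i\in I_0}C_i=\vec0$ and, for each $u\in\{1,\dots,r\}$, $\sum_{i\in I_u}C_i\in\operatorname{span}_{\mathbb{Q}}\{C_j:j\in I_0\cup\dots\cup I_{u-1}\}$ (a matrix with no rows satisfies it trivially). For $\vec t\in\mathbb{N}^n$, $\alpha\cdot\vec t=\sum_j\alpha(j)t_j$; $\vec t$ is $c$-monochromatic for a finite coloring $c$ of $\mathbb{N}$ if $c(t_1)=\dots=c(t_n)$. A Rado partition of $\operatorname{supp}(P)$ is a tuple $(J_0,\dots,J_l)$ of nonempty sets partitioning $\operatorname{supp}(P)$ such that for every finite coloring $c$ of $\mathbb{N}$ there are infinitely many $c$-monochromatic $\vec t\in\mathbb{N}^n$ such that $J_0,\dots,J_l$ are exactly the fibers of the map $\alpha\mapsto\alpha\cdot\vec t$ on $\operatorname{supp}(P)$. A Rado set for $P$ is any member of some Rado partition. -}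

module Defs where

open import Level using (Level)
open import Algebra.Bundles using (CommutativeRing)
open import Data.Nat as ℕ using (ℕ; zero; suc; _≤_)
open import Data.Integer as ℤ using (ℤ; +_)
open import Data.Rational as ℚ using (ℚ; 0ℚ; _/_)
open import Data.Fin as Fin using (Fin; toℕ)
open import Data.Fin.Properties using (_≟_; _<?_)
open import Data.Vec using (Vec; lookup; []; _∷_)
open import Data.List using (List; []; _∷_; length; concat)
import Data.List as L
open import Data.List.Membership.Propositional using (_∈_; _∉_)
open import Data.List.Relation.Unary.All using (All)
open import Data.List.Relation.Unary.Any using (Any)
open import Data.List.Relation.Unary.Unique.Propositional using (Unique)
open import Data.List.Relation.Binary.Permutation.Propositional using (_↭_)
open import Data.Product using (Σ; ∃; _×_; _,_)
open import Data.Sum using (_⊎_)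
open import Data.Empty using (⊥)
open import Relation.Nullary using (¬_; does)
open import Relation.Binary.PropositionalEquality using (_≡_; _≢_)
open import Data.Bool using (if_then_else_)
open import Function.Bundles using (_⇔_)

record Poly {c ℓ : Level} (R : CommutativeRing c ℓ) (n : ℕ) : Set (c Level.⊔ ℓ) where
  open CommutativeRing R
  field
    coeff       : Vec ℕ n → Carrier
    supp        : List (Vec ℕ n)
    supp-unique : Unique supp
    supp-spec   : ∀ α → α ∈ supp ⇔ (¬ (coeff α ≈ 0#))

open Poly public

_·_ : ∀ {n} → Vec ℕ n → Vec ℕ n → ℕ
[] · [] = 0
(a ∷ as) · (t ∷ ts) = a ℕ.* t ℕ.+ (as · ts)

-- t ∈ ℕ^n with ℕ = {1,2,…}
Positive : ∀ {n} → Vec ℕ n → Set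
Positive {n} t = ∀ (i : Fin n) → 1 ≤ lookup t i

Monochromatic : ∀ {m n} → (ℕ → Fin m) → Vec ℕ n → Set
Monochromatic {n = n} col t = ∀ (i j : Fin n) → col (lookup t i) ≡ col (lookup t j)

RadoPartition : ∀ {c ℓ} (R : CommutativeRing c ℓ) (n : ℕ) → Poly R n →
                List (List (Vec ℕ n)) → Set
RadoPartition R n P blocks =
    All (λ B → B ≢ []) blocks
  × concat blocks ↭ supp P
  × (∀ (m : ℕ) (col : ℕ → Fin m) (avoid : List (Vec ℕ n)) →
       -- infinitely many t: for every finite list of vectors there is a t outside it
       ∃ λ (t : Vec ℕ n) → t ∉ avoid × Positive t × Monochromatic col t ×
         (∀ α β → α ∈ supp P → β ∈ supp P →
            ((α · t) ≡ (β · t)) ⇔ Any (λ B → α ∈ B × β ∈ B) blocks))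

RadoSet : ∀ {c ℓ} (R : CommutativeRing c ℓ) (n : ℕ) → Poly R n → List (Vec ℕ n) → Set
RadoSet R n P J = ∃ λ blocks → RadoPartition R n P blocks × J ∈ blocks

∑ : ∀ {n} → (Fin n → ℚ) → ℚ
∑ {zero} f = 0ℚ
∑ {suc n} f = f Fin.zero ℚ.+ ∑ (λ i → f (Fin.suc i))

-- The partition I_0,…,I_r is given by the block-labelling f : Fin n → Fin (suc r),
-- I_u = f⁻¹(u); surjectivity of f = all blocks nonempty.
ColumnsCondition : ∀ {n} (Row : Set) → (Row → Fin n → ℚ) → Set
ColumnsCondition {n} Row A =
    (Row → ⊥)   -- a matrix with no rows satisfies it trivially
  ⊎ (∃ λ (r : ℕ) → ∃ λ (f : Fin n → Fin (suc r)) →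
        (∀ (u : Fin (suc r)) → ∃ λ (i : Fin n) → f i ≡ u)
      × (∀ (x : Row) → ∑ (λ i → if does (f i ≟ Fin.zero) then A x i else 0ℚ) ≡ 0ℚ)
      × (∀ (u : Fin (suc r)) → u ≢ Fin.zero →
           ∃ λ (λs : Fin n → ℚ) → ∀ (x : Row) →
             ∑ (λ i → if does (f i ≟ u) then A x i else 0ℚ)
               ≡ ∑ (λ i → if does (f i <? u) then λs i ℚ.* A x i else 0ℚ)))

Mat : ∀ {n} (J : List (Vec ℕ n)) (j : Fin (length J)) →
      (Σ (Fin (length J)) (λ i → i ≢ j)) → Fin n → ℚ
Mat J j (i , _) col =
  ((+ lookup (L.lookup J i) col) ℤ.- (+ lookup (L.lookup J j) col)) / 1

-- Let A be the integer matrix with rows αᵢ − αⱼ.  For a prime p, colour x by the last nonzero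
-- base-p digit of x.  The Rado property yields a monochromatic positive solution of A t = 0,
-- so tᵢ = p^kᵢ qᵢ with all qᵢ ≡ d ≢ 0 (mod p); group the columns by the level kᵢ.  If at some
-- level v the sum of the level-v columns were not a rational combination of the lower columns,
-- Gaussian elimination would give an integer vector W orthogonal to the lower columns with
-- N = W · (level-v sum) ≠ 0.  Dividing W · A t = 0 by pᵛ and reducing mod p gives p ∣ N d.  Only
-- finitely many such elimination problems arise, so |N| is bounded independently of p, and a prime p
-- above that bound gives a contradiction.  Ranking the levels yields the partition I₀, …, I_r.

module Submission where

open import Defs
open import Algebra.Bundles using (CommutativeRing)
open import Data.Bool using (Bool; true; false; if_then_else_)
open import Data.Empty using (⊥-elim)
open import Data.Fin as Fin using (Fin; zero; suc; toℕ; fromℕ<)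
open import Data.Fin.Properties as FinP using (_≟_; all?; any?; ¬∀⟶∃¬; toℕ-fromℕ<; toℕ-injective)
open import Data.Integer as ℤ using (ℤ; +_; 0ℤ; 1ℤ; _+_; _*_; _-_; -_; ∣_∣)
open import Data.Integer.Properties as ℤP using (+-*-semiring)
open import Data.Integer.Tactic.RingSolver using (solve-∀)
open import Data.List using (List; []; _∷_; length)
import Data.List as L
open import Data.List.Membership.Propositional using (_∈_)
open import Data.List.Membership.Propositional.Properties using (∈-lookup; ∈-concat⁺′)
open import Data.List.Relation.Binary.Permutation.Propositional.Properties using (∈-resp-↭)
open import Data.List.Relation.Unary.All using (All; _∷_)
open import Data.List.Relation.Unary.Any as Any using (here)
open import Data.Nat as ℕ using (ℕ; zero; suc; _≤_; _<_; _⊔_; _∸_; _^_; _%_; _/_; _!; NonZero; nonTrivial⇒≢1; nonTrivial⇒n>1)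
open import Data.Nat.Coprimality as Coprime using (1-coprimeTo)
import Data.Nat.Divisibility as ℕ∣
open import Data.Nat.DivMod using (_mod_; m≡m%n+[m/n]*n; m/n<m; m%n<n)
open import Data.Nat.ListAction using (product)
open import Data.Nat.Primality using (Prime; euclidsLemma; prime⇒nonZero; prime⇒nonTrivial)
open import Data.Nat.Primality.Factorisation using (factorise; PrimeFactorisation)
open import Data.Nat.Properties as ℕP using (≤-refl; ≤-trans; m≤m⊔n; m≤n⊔m)
import Data.Nat.Tactic.RingSolver as ℕSolver
open import Data.Product using (Σ; ∃; ∃₂; _×_; _,_; proj₁; proj₂; map₁)
open import Data.Rational as ℚ using (ℚ; 0ℚ; mkℚ)
import Data.Rational.Properties as ℚP
open import Data.Sum as Sum using (_⊎_; inj₁; inj₂)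
open import Data.Vec using (Vec; []; _∷_; lookup; tabulate)
open import Data.Vec.Properties using (lookup∘tabulate)
open import Function using (_∘_; _⇔_; mk⇔; Equivalence)
open import Function.Construct.Symmetry using (⇔-sym)
open import Relation.Binary.Definitions using (tri<; tri≈; tri>)
open import Relation.Binary.PropositionalEquality
open import Relation.Nullary using (¬_; Dec; yes; no; does; contradiction)
open import Relation.Nullary.Decidable using (dec-true; dec-false; does-⇔)
open ≡-Reasoning

open import Algebra.Properties.Semiring.Sum +-*-semiring
  using (sum; sum-cong-≗; ∑-distrib-+; ∑-comm; *-distribˡ-sum; *-distribʳ-sum; sum-replicate-zero)
open import Algebra.Properties.Semiring.Divisibility +-*-semiring using (_∣_; _,_; _∣0; x∣ʳy⇒x∣ʳzy)

-- Integer linear algebra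

sum-zero : ∀ {n} (f : Fin n → ℤ) → (∀ i → f i ≡ 0ℤ) → sum f ≡ 0ℤ
sum-zero {n} f f≡0 = trans (sum-cong-≗ f≡0) (sum-replicate-zero n)

sum-linear : ∀ {n} a b (f g : Fin n → ℤ) →
             sum (λ i → a * f i + b * g i) ≡ a * sum f + b * sum g
sum-linear a b f g = begin
  sum (λ i → a * f i + b * g i)              ≡⟨ ∑-distrib-+ (λ i → a * f i) (λ i → b * g i) ⟩
  sum (λ i → a * f i) + sum (λ i → b * g i)  ≡⟨ cong₂ _+_ (*-distribˡ-sum a f) (*-distribˡ-sum b g) ⟨
  a * sum f + b * sum g                      ∎

masked : ∀ b a → a * (if b then 1ℤ else 0ℤ) ≡ (if b then a else 0ℤ)
masked true  a = ℤP.*-identityʳ a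
masked false a = ℤP.*-zeroʳ a

dot : ∀ {K} → (Fin K → ℤ) → (Fin K → ℤ) → ℤ
dot u v = sum (λ x → u x * v x)

dot-congʳ : ∀ {K} (W : Fin K → ℤ) {v v′ : Fin K → ℤ} → (∀ x → v x ≡ v′ x) → dot W v ≡ dot W v′
dot-congʳ W v≗v′ = sum-cong-≗ (λ x → cong (W x *_) (v≗v′ x))

dot-mat : ∀ {K n} (W : Fin K → ℤ) (A : Fin K → Fin n → ℤ) (t : Fin n → ℤ) →
          sum (λ i → dot W (λ x → A x i) * t i) ≡ dot W (λ x → sum (λ i → A x i * t i))
dot-mat W A t = begin
  sum (λ i → dot W (λ x → A x i) * t i)        ≡⟨ sum-cong-≗ (λ i → *-distribʳ-sum (t i) (λ x → W x * A x i)) ⟩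
  sum (λ i → sum (λ x → W x * A x i * t i))    ≡⟨ ∑-comm (λ i x → W x * A x i * t i) ⟩
  sum (λ x → sum (λ i → W x * A x i * t i))    ≡⟨ sum-cong-≗ (λ x → sum-cong-≗ (λ i → ℤP.*-assoc (W x) (A x i) (t i))) ⟩
  sum (λ x → sum (λ i → W x * (A x i * t i)))  ≡⟨ sum-cong-≗ (λ x → *-distribˡ-sum (W x) (λ i → A x i * t i)) ⟨
  dot W (λ x → sum (λ i → A x i * t i))        ∎

δ : ∀ {K} → Fin K → Fin K → ℤ
δ r x = if does (x ≟ r) then 1ℤ else 0ℤ

dot-δ : ∀ {K} (r : Fin K) (v : Fin K → ℤ) → dot (δ r) v ≡ v r
dot-δ {suc K} zero v = begin
  1ℤ * v zero + sum (λ x → 0ℤ * v (suc x)) ≡⟨ cong₂ _+_ (ℤP.*-identityˡ (v zero)) (sum-zero _ (λ x → ℤP.*-zeroˡ (v (suc x)))) ⟩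
  v zero + 0ℤ                               ≡⟨ ℤP.+-identityʳ (v zero) ⟩
  v zero                                    ∎
dot-δ {suc K} (suc r) v = begin
  0ℤ * v zero + dot (δ r) (λ x → v (suc x)) ≡⟨ cong₂ _+_ (ℤP.*-zeroˡ (v zero)) (dot-δ r (λ x → v (suc x))) ⟩
  0ℤ + v (suc r)                             ≡⟨ ℤP.+-identityˡ (v (suc r)) ⟩
  v (suc r)                                  ∎

-- Over ℤ, with the denominators of a rational combination cleared by c.
InSpan : ∀ {k K} → (Fin k → Fin K → ℤ) → (Fin K → ℤ) → Set
InSpan {k} D b = ∃₂ λ (c : ℤ) (μ : Fin k → ℤ) → c ≢ 0ℤ × ∀ x → c * b x ≡ sum (λ j → μ j * D j x)

Separated : ∀ {k K} → (Fin k → Fin K → ℤ) → (Fin K → ℤ) → Set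
Separated {K = K} D b = ∃ λ (W : Fin K → ℤ) → (∀ j → dot W (D j) ≡ 0ℤ) × dot W b ≢ 0ℤ

inSpan-resp : ∀ {k K} {D D′ : Fin k → Fin K → ℤ} {b b′ : Fin K → ℤ} →
              (∀ j x → D j x ≡ D′ j x) → (∀ x → b x ≡ b′ x) → InSpan D b → InSpan D′ b′
inSpan-resp D≗D′ b≗b′ (c , μ , c≢0 , eq) =
  c , μ , c≢0 , λ x → trans (cong (c *_) (sym (b≗b′ x))) (trans (eq x) (sum-cong-≗ (λ j → cong (μ j *_) (D≗D′ j x))))

inSpan-tail⇒inSpan : ∀ {k K} (D : Fin (suc k) → Fin K → ℤ) (b : Fin K → ℤ) →
                     InSpan (λ j → D (suc j)) b → InSpan D b
inSpan-tail⇒inSpan D b (c , μ , c≢0 , eq) = c , μ′ , c≢0 , λ x → begin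
  c * b x                                          ≡⟨ eq x ⟩
  sum (λ j → μ j * D (suc j) x)                    ≡⟨ ℤP.+-identityˡ _ ⟨
  0ℤ + sum (λ j → μ j * D (suc j) x)               ≡⟨ cong (_+ sum (λ j → μ j * D (suc j) x)) (ℤP.*-zeroˡ (D zero x)) ⟨
  0ℤ * D zero x + sum (λ j → μ j * D (suc j) x)    ∎
  where
  μ′ : Fin (suc _) → ℤ
  μ′ zero    = 0ℤ
  μ′ (suc j) = μ j

separated-tail⇒separated : ∀ {k K} (D : Fin (suc k) → Fin K → ℤ) (b : Fin K → ℤ) → (∀ x → D zero x ≡ 0ℤ) →
                           Separated (λ j → D (suc j)) b → Separated D b
separated-tail⇒separated D b D₀≡0 (W , orth , nz) = W , orth′ , nz
  where
  orth′ : ∀ j → dot W (D j) ≡ 0ℤ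
  orth′ zero    = sum-zero _ (λ x → trans (cong (W x *_) (D₀≡0 x)) (ℤP.*-zeroʳ (W x)))
  orth′ (suc j) = orth j

-- Clearing coordinate r against the pivot column D zero: spans and separators of the reduced
-- system lift back to the original one.
module Pivot {k K} (D : Fin (suc k) → Fin K → ℤ) (r : Fin K) (pivot≢0 : D zero r ≢ 0ℤ) where

  private
    v : Fin K → ℤ
    v = D zero
    a : ℤ
    a = v r

  eliminate : (Fin K → ℤ) → Fin K → ℤ
  eliminate y x = a * y x - y r * v x

  Reduced : Fin k → Fin K → ℤ
  Reduced j = eliminate (D (suc j))

  eliminate-pivot : ∀ x → eliminate v x ≡ 0ℤ
  eliminate-pivot x = ℤP.+-inverseʳ (a * v x)

  liftSeparator : (Fin K → ℤ) → Fin K → ℤ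
  liftSeparator W x = a * W x - dot W v * δ r x

  dot-liftSeparator : ∀ W y → dot (liftSeparator W) y ≡ dot W (eliminate y)
  dot-liftSeparator W y = begin
    dot (liftSeparator W) y                                    ≡⟨ sum-cong-≗ (λ x → expandˡ a (W x) (y x) (dot W v) (δ r x)) ⟩
    sum (λ x → a * (W x * y x) + (- dot W v) * (δ r x * y x))  ≡⟨ sum-linear a (- dot W v) (λ x → W x * y x) (λ x → δ r x * y x) ⟩
    a * dot W y + (- dot W v) * dot (δ r) y                    ≡⟨ cong (λ z → a * dot W y + (- dot W v) * z) (dot-δ r y) ⟩
    a * dot W y + (- dot W v) * y r                            ≡⟨ swap (a * dot W y) (dot W v) (y r) ⟩
    a * dot W y + (- y r) * dot W v                            ≡⟨ sum-linear a (- y r) (λ x → W x * y x) (λ x → W x * v x) ⟨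
    sum (λ x → a * (W x * y x) + (- y r) * (W x * v x))        ≡⟨ sum-cong-≗ (λ x → expandʳ a (W x) (y x) (y r) (v x)) ⟨
    dot W (eliminate y)                                        ∎
    where
    expandˡ : ∀ a w y s d → (a * w - s * d) * y ≡ a * (w * y) + (- s) * (d * y)
    expandˡ = solve-∀
    expandʳ : ∀ a w y s v → w * (a * y - s * v) ≡ a * (w * y) + (- s) * (w * v)
    expandʳ = solve-∀
    swap : ∀ m s t → m + (- s) * t ≡ m + (- t) * s
    swap = solve-∀

  separated-lift : ∀ b → Separated Reduced (eliminate b) → Separated D b
  separated-lift b (W , orth , nz) = liftSeparator W , orth′ , λ e → nz (trans (sym (dot-liftSeparator W b)) e)
    where
    orth′ : ∀ j → dot (liftSeparator W) (D j) ≡ 0ℤ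
    orth′ zero    = trans (dot-liftSeparator W v)
                          (sum-zero _ (λ x → trans (cong (W x *_) (eliminate-pivot x)) (ℤP.*-zeroʳ (W x))))
    orth′ (suc j) = trans (dot-liftSeparator W (D (suc j))) (orth j)

  inSpan-lift : ∀ b → InSpan Reduced (eliminate b) → InSpan D b
  inSpan-lift b (c , μ , c≢0 , eq) = c * a , μ′ , c*a≢0 , λ x → solveFor x (eq′ x)
    where
    S : Fin K → ℤ
    S x = sum (λ j → μ j * D (suc j) x)
    μ′ : Fin (suc k) → ℤ
    μ′ zero    = c * b r - S r
    μ′ (suc j) = μ j * a
    c*a≢0 : c * a ≢ 0ℤ
    c*a≢0 e = Sum.[ c≢0 , pivot≢0 ] (ℤP.i*j≡0⇒i≡0∨j≡0 c e)
    distribute : ∀ m a d dr vx → m * (a * d - dr * vx) ≡ a * (m * d) + (- vx) * (m * dr)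
    distribute = solve-∀
    eq′ : ∀ x → c * eliminate b x ≡ a * S x + (- v x) * S r
    eq′ x = trans (eq x) (trans (sum-cong-≗ (λ j → distribute (μ j) a (D (suc j) x) (D (suc j) r) (v x)))
                                (sum-linear a (- v x) (λ j → μ j * D (suc j) x) (λ j → μ j * D (suc j) r)))
    a*S : ∀ x → a * S x ≡ sum (λ j → μ j * a * D (suc j) x)
    a*S x = trans (*-distribˡ-sum a (λ j → μ j * D (suc j) x))
                  (sum-cong-≗ (λ j → trans (sym (ℤP.*-assoc a (μ j) _)) (cong (_* D (suc j) x) (ℤP.*-comm a (μ j)))))
    expand : ∀ c a bx br vx → c * a * bx ≡ c * (a * bx - br * vx) + c * br * vx
    expand = solve-∀
    collect : ∀ a Sx vx Sr cbr → a * Sx + (- vx) * Sr + cbr * vx ≡ (cbr - Sr) * vx + a * Sx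
    collect = solve-∀
    solveFor : ∀ x → c * eliminate b x ≡ a * S x + (- v x) * S r →
               c * a * b x ≡ μ′ zero * v x + sum (λ j → μ′ (suc j) * D (suc j) x)
    solveFor x e = begin
      c * a * b x                                            ≡⟨ expand c a (b x) (b r) (v x) ⟩
      c * eliminate b x + c * b r * v x                      ≡⟨ cong (λ z → z + c * b r * v x) e ⟩
      a * S x + (- v x) * S r + c * b r * v x                ≡⟨ collect a (S x) (v x) (S r) (c * b r) ⟩
      μ′ zero * v x + a * S x                                ≡⟨ cong (λ z → μ′ zero * v x + z) (a*S x) ⟩
      μ′ zero * v x + sum (λ j → μ′ (suc j) * D (suc j) x)   ∎

inSpan⊎separated : ∀ {k K} (D : Fin k → Fin K → ℤ) (b : Fin K → ℤ) → InSpan D b ⊎ Separated D b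
inSpan⊎separated {zero} D b with all? (λ x → b x ℤ.≟ 0ℤ)
... | yes b≡0 = inj₁ (1ℤ , (λ ()) , (λ ()) , λ x → trans (ℤP.*-identityˡ (b x)) (b≡0 x))
... | no b≢0 with ¬∀⟶∃¬ _ _ (λ x → b x ℤ.≟ 0ℤ) b≢0
...   | x , bx≢0 = inj₂ (δ x , (λ ()) , λ e → bx≢0 (trans (sym (dot-δ x b)) e))
inSpan⊎separated {suc k} D b with all? (λ x → D zero x ℤ.≟ 0ℤ)
... | yes D₀≡0 = Sum.map (inSpan-tail⇒inSpan D b) (separated-tail⇒separated D b D₀≡0) (inSpan⊎separated (λ j → D (suc j)) b)
... | no D₀≢0 with ¬∀⟶∃¬ _ _ (λ x → D zero x ℤ.≟ 0ℤ) D₀≢0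
...   | r , pivot≢0 = Sum.map (inSpan-lift b) (separated-lift b) (inSpan⊎separated Reduced (eliminate b))
  where open Pivot D r pivot≢0

subsets-bounded : ∀ {n} (φ : Vec Bool n → ℕ) → ∃ λ B → ∀ S → φ S ≤ B
subsets-bounded {zero} φ = φ [] , λ { [] → ≤-refl }
subsets-bounded {suc n} φ with subsets-bounded (φ ∘ (false ∷_)) | subsets-bounded (φ ∘ (true ∷_))
... | B₀ , φ₀≤B₀ | B₁ , φ₁≤B₁ = B₀ ⊔ B₁ , λ
  { (false ∷ S) → ≤-trans (φ₀≤B₀ S) (m≤m⊔n B₀ B₁)
  ; (true ∷ S)  → ≤-trans (φ₁≤B₁ S) (m≤n⊔m B₀ B₁)
  }

SeparatedWithin : ∀ {k K} → ℕ → (Fin k → Fin K → ℤ) → (Fin K → ℤ) → Set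
SeparatedWithin {K = K} B D b =
  ∃ λ (W : Fin K → ℤ) → (∀ j → dot W (D j) ≡ 0ℤ) × dot W b ≢ 0ℤ × ∣ dot W b ∣ ≤ B

separatedWithin-resp : ∀ {k K B} {D D′ : Fin k → Fin K → ℤ} {b b′ : Fin K → ℤ} →
                       (∀ j x → D j x ≡ D′ j x) → (∀ x → b x ≡ b′ x) → SeparatedWithin B D b → SeparatedWithin B D′ b′
separatedWithin-resp {b = b} {b′} D≗D′ b≗b′ (W , orth , nz , ≤B) =
  W , (λ j → trans (sym (dot-congʳ W (D≗D′ j))) (orth j)) ,
  subst (λ N → N ≢ 0ℤ) N≡N′ nz , subst (λ N → ∣ N ∣ ≤ _) N≡N′ ≤B
  where
  N≡N′ : dot W b ≡ dot W b′
  N≡N′ = dot-congʳ W b≗b′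

uniform-separation : ∀ {m n k K} (D : Vec Bool m → Fin k → Fin K → ℤ) (b : Vec Bool n → Fin K → ℤ) →
                     ∃ λ B → ∀ E S → InSpan (D E) (b S) ⊎ SeparatedWithin B (D E) (b S)
uniform-separation D b = B , λ E S → within (inSpan⊎separated (D E) (b S)) (≤-trans (≤B E S) (≤B′ E))
  where
  gap : ∀ {k K} {D : Fin k → Fin K → ℤ} {b} → InSpan D b ⊎ Separated D b → ℕ
  gap             (inj₁ _)       = 0
  gap {b = b} (inj₂ (W , _)) = ∣ dot W b ∣
  rowBound : Vec Bool _ → ℕ
  rowBound E = proj₁ (subsets-bounded (λ S → gap (inSpan⊎separated (D E) (b S))))
  ≤B : ∀ E S → gap (inSpan⊎separated (D E) (b S)) ≤ rowBound E
  ≤B E = proj₂ (subsets-bounded (λ S → gap (inSpan⊎separated (D E) (b S))))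
  B : ℕ
  B = proj₁ (subsets-bounded rowBound)
  ≤B′ : ∀ E → rowBound E ≤ B
  ≤B′ = proj₂ (subsets-bounded rowBound)
  within : ∀ {k K} {D : Fin k → Fin K → ℤ} {b} (r : InSpan D b ⊎ Separated D b) → gap r ≤ B →
           InSpan D b ⊎ SeparatedWithin B D b
  within (inj₁ s)                _ = inj₁ s
  within (inj₂ (W , orth , nz)) le = inj₂ (W , orth , nz , le)

-- Primes and p-adic valuations

∣n! : ∀ {m} n → 1 ≤ m → m ≤ n → m ℕ∣.∣ n !
∣n! {m} zero    1≤m m≤0 = ⊥-elim (ℕP.<⇒≱ 1≤m m≤0)
∣n! {m} (suc n) 1≤m m≤n with m ℕ.≟ suc n
... | yes refl = ℕ∣.m∣m*n (n !)
... | no m≢n   = ℕ∣.∣-trans (∣n! n 1≤m (ℕP.≤-pred (ℕP.≤∧≢⇒< m≤n m≢n))) (ℕ∣.n∣m*n (suc n))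

-- Euclid: a prime factor of B ! + 1 exceeds B.
prime> : ∀ B → ∃ λ p → Prime p × B < p
prime> B = firstFactor factors isFactorisation factorsPrime
  where
  open PrimeFactorisation (factorise (suc (B !)))
  firstFactor : (ps : List ℕ) → suc (B !) ≡ product ps → All Prime ps → ∃ λ p → Prime p × B < p
  firstFactor []       e _          = ⊥-elim (ℕP.<⇒≢ (ℕP.1≤n! B) (sym (ℕP.suc-injective e)))
  firstFactor (p ∷ ps) e (p-prime ∷ _) with B ℕ.<? p
  ... | yes B<p = p , p-prime , B<p
  ... | no B≮p  = ⊥-elim (nonTrivial⇒≢1 {{prime⇒nonTrivial p-prime}} (ℕ∣.∣1⇒≡1 (ℕ∣.∣m+n∣m⇒∣n p∣B!+1 (∣n! B 1≤p (ℕP.≮⇒≥ B≮p)))))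
    where
    1≤p : 1 ≤ p
    1≤p = ℕP.<⇒≤ (nonTrivial⇒n>1 p {{prime⇒nonTrivial p-prime}})
    p∣B!+1 : p ℕ∣.∣ B ! ℕ.+ 1
    p∣B!+1 = subst (p ℕ∣.∣_) (trans (sym e) (ℕP.+-comm 1 (B !))) (ℕ∣.m∣m*n (product ps))

module PAdic (p : ℕ) .{{_ : NonZero p}} (1<p : 1 < p) where

  -- Fuel x suffices, since every step divides x by p.
  split : (fuel x : ℕ) → ℕ × ℕ
  split zero       x = 0 , x
  split (suc fuel) x with x % p ℕ.≟ 0
  ... | yes _ = map₁ suc (split fuel (x / p))
  ... | no _  = 0 , x

  valuation unitPart : ℕ → ℕ
  valuation x = proj₁ (split x x)
  unitPart  x = proj₂ (split x x)

  split-spec : ∀ fuel x → 1 ≤ x → x ≤ fuel →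
               x ≡ p ^ proj₁ (split fuel x) ℕ.* proj₂ (split fuel x) × proj₂ (split fuel x) % p ≢ 0
  split-spec zero       x 1≤x x≤0 = ⊥-elim (ℕP.<⇒≱ 1≤x x≤0)
  split-spec (suc fuel) x 1≤x x≤fuel with x % p ℕ.≟ 0
  ... | no x%p≢0 = sym (ℕP.+-identityʳ x) , x%p≢0
  ... | yes x%p≡0 = x≡ , proj₂ IH
    where
    k q : ℕ
    k = proj₁ (split fuel (x / p))
    q = proj₂ (split fuel (x / p))
    x≡[x/p]*p : x ≡ x / p ℕ.* p
    x≡[x/p]*p = trans (m≡m%n+[m/n]*n x p) (cong (ℕ._+ x / p ℕ.* p) x%p≡0)
    1≤x/p : 1 ≤ x / p
    1≤x/p = ℕP.n≢0⇒n>0 λ x/p≡0 → ℕP.<⇒≢ 1≤x (sym (trans x≡[x/p]*p (cong (ℕ._* p) x/p≡0)))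
    IH : x / p ≡ p ^ k ℕ.* q × q % p ≢ 0
    IH = split-spec fuel (x / p) 1≤x/p (ℕP.≤-pred (≤-trans (m/n<m x p {{ℕ.>-nonZero 1≤x}} 1<p) x≤fuel))
    x≡ : x ≡ p ^ suc k ℕ.* q
    x≡ = begin
      x                     ≡⟨ x≡[x/p]*p ⟩
      x / p ℕ.* p           ≡⟨ cong (ℕ._* p) (proj₁ IH) ⟩
      p ^ k ℕ.* q ℕ.* p     ≡⟨ rotate (p ^ k) q p ⟩
      p ℕ.* p ^ k ℕ.* q     ∎
      where
      rotate : ∀ a b c → a ℕ.* b ℕ.* c ≡ c ℕ.* a ℕ.* b
      rotate = ℕSolver.solve-∀

  unitPart-spec : ∀ x → 1 ≤ x → x ≡ p ^ valuation x ℕ.* unitPart x × unitPart x % p ≢ 0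
  unitPart-spec x 1≤x = split-spec x x 1≤x ≤-refl

∣-+ : ∀ {x y z} → x ∣ y → x ∣ z → x ∣ y + z
∣-+ {x} (q , qx≡y) (q′ , q′x≡z) = q + q′ , trans (ℤP.*-distribʳ-+ x q q′) (cong₂ _+_ qx≡y q′x≡z)

∣-sum : ∀ {n x} (f : Fin n → ℤ) → (∀ i → x ∣ f i) → x ∣ sum f
∣-sum {zero}  {x} f _   = x ∣0
∣-sum {suc n}     f x∣f = ∣-+ (x∣f zero) (∣-sum (λ i → f (suc i)) (λ i → x∣f (suc i)))

∣-neg : ∀ {x y} → x ∣ - y → x ∣ y
∣-neg {x} {y} (q , qx≡-y) = - q , trans (sym (ℤP.neg-distribˡ-* q x)) (trans (cong -_ qx≡-y) (ℤP.neg-involutive y))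

module _ (p : ℕ) .{{_ : NonZero p}} where

  p∣p^e*q : ∀ e q → 0 < e → + p ∣ + (p ^ e ℕ.* q)
  p∣p^e*q (suc e) q _ = + (p ^ e ℕ.* q) , (begin
    + (p ^ e ℕ.* q) * + p       ≡⟨ ℤP.pos-* (p ^ e ℕ.* q) p ⟨
    + (p ^ e ℕ.* q ℕ.* p)       ≡⟨ cong +_ (ℕP.*-comm (p ^ e ℕ.* q) p) ⟩
    + (p ℕ.* (p ^ e ℕ.* q))     ≡⟨ cong +_ (ℕP.*-assoc p (p ^ e) q) ⟨
    + (p ^ suc e ℕ.* q)         ∎)

  -- Dividing Σ cᵢ pᵏⁱ qᵢ = 0 by pᵛ and reducing mod p leaves only the terms of level v.
  level-divisible : ∀ {n} (k q : Fin n → ℕ) (d v : ℕ) (c : Fin n → ℤ) →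
                    (∀ i → q i % p ≡ d) → (∀ i → k i < v → c i ≡ 0ℤ) →
                    sum (λ i → c i * + (p ^ k i ℕ.* q i)) ≡ 0ℤ →
                    + p ∣ sum (λ i → if does (k i ℕ.≟ v) then c i else 0ℤ) * + d
  level-divisible {n} k q d v c q%p≡d below≡0 Σ≡0 =
    ∣-neg (subst (+ p ∣_) Σterms≡-N*d (∣-sum terms term-divisible))
    where
    s : Fin n → ℕ
    s i = p ^ (k i ∸ v) ℕ.* q i

    N : ℤ
    N = sum (λ i → if does (k i ℕ.≟ v) then c i else 0ℤ)

    terms : Fin n → ℤ
    terms i = c i * (+ s i - (if does (k i ℕ.≟ v) then + d else 0ℤ))

    scaled : ∀ i → c i * + (p ^ k i ℕ.* q i) ≡ + (p ^ v) * (c i * + s i)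
    scaled i with k i ℕ.<? v
    ... | yes k<v rewrite below≡0 i k<v = sym (ℤP.*-zeroʳ (+ (p ^ v)))
    ... | no k≮v = begin
      c i * + (p ^ k i ℕ.* q i)                    ≡⟨ cong (λ e → c i * + (p ^ e ℕ.* q i)) (ℕP.m+[n∸m]≡n (ℕP.≮⇒≥ k≮v)) ⟨
      c i * + (p ^ (v ℕ.+ (k i ∸ v)) ℕ.* q i)      ≡⟨ cong (λ z → c i * + (z ℕ.* q i)) (ℕP.^-distribˡ-+-* p v (k i ∸ v)) ⟩
      c i * + (p ^ v ℕ.* p ^ (k i ∸ v) ℕ.* q i)    ≡⟨ cong (λ z → c i * + z) (ℕP.*-assoc (p ^ v) _ (q i)) ⟩
      c i * + (p ^ v ℕ.* s i)                      ≡⟨ cong (c i *_) (ℤP.pos-* (p ^ v) (s i)) ⟩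
      c i * (+ (p ^ v) * + s i)                    ≡⟨ commute (c i) (+ (p ^ v)) (+ s i) ⟩
      + (p ^ v) * (c i * + s i)                    ∎
      where
      commute : ∀ c P s → c * (P * s) ≡ P * (c * s)
      commute = solve-∀

    pᵛ*Σcs≡0 : + (p ^ v) * sum (λ i → c i * + s i) ≡ 0ℤ
    pᵛ*Σcs≡0 = trans (*-distribˡ-sum (+ (p ^ v)) (λ i → c i * + s i)) (trans (sum-cong-≗ (λ i → sym (scaled i))) Σ≡0)

    Σcs≡0 : sum (λ i → c i * + s i) ≡ 0ℤ
    Σcs≡0 with ℤP.i*j≡0⇒i≡0∨j≡0 (+ (p ^ v)) pᵛ*Σcs≡0
    ... | inj₁ pᵛ≡0 = ⊥-elim (ℕ.≢-nonZero⁻¹ (p ^ v) {{ℕP.m^n≢0 p v}} (cong ∣_∣ pᵛ≡0))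
    ... | inj₂ Σcs≡0 = Σcs≡0

    term-divisible : ∀ i → + p ∣ terms i
    term-divisible i = divisible (k i ℕ.<? v) (k i ℕ.≟ v)
      where
      divisible : Dec (k i < v) → (k≟v : Dec (k i ≡ v)) → + p ∣ c i * (+ s i - (if does k≟v then + d else 0ℤ))
      divisible (yes k<v) k≟v rewrite below≡0 i k<v = subst (+ p ∣_) (sym (ℤP.*-zeroˡ (+ s i - (if does k≟v then + d else 0ℤ)))) ((+ p) ∣0)
      divisible (no _) (yes k≡v) = x∣ʳy⇒x∣ʳzy (c i) (+ (q i / p) , sym qᵢ-d≡)
        where
        qᵢ-d≡ : + s i - + d ≡ + (q i / p) * + p
        qᵢ-d≡ = begin
          + s i - + d                               ≡⟨ cong (λ e → + (p ^ e ℕ.* q i) - + d) (trans (cong (_∸ v) k≡v) (ℕP.n∸n≡0 v)) ⟩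
          + (1 ℕ.* q i) - + d                       ≡⟨ cong (λ z → + z - + d) (trans (ℕP.*-identityˡ (q i)) (m≡m%n+[m/n]*n (q i) p)) ⟩
          + (q i % p ℕ.+ q i / p ℕ.* p) - + d       ≡⟨ cong (λ z → + (z ℕ.+ q i / p ℕ.* p) - + d) (q%p≡d i) ⟩
          + (d ℕ.+ q i / p ℕ.* p) - + d             ≡⟨ cong (_- + d) (ℤP.pos-+ d (q i / p ℕ.* p)) ⟩
          + d + + (q i / p ℕ.* p) - + d             ≡⟨ cancel (+ d) (+ (q i / p ℕ.* p)) ⟩
          + (q i / p ℕ.* p)                         ≡⟨ ℤP.pos-* (q i / p) p ⟩
          + (q i / p) * + p                         ∎
          where
          cancel : ∀ a b → a + b - a ≡ b
          cancel = solve-∀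
      divisible (no k≮v) (no k≢v) = x∣ʳy⇒x∣ʳzy (c i) (subst (+ p ∣_) (sym (ℤP.+-identityʳ (+ s i)))
                                (p∣p^e*q (k i ∸ v) (q i) (ℕP.m<n⇒0<n∸m (ℕP.≤∧≢⇒< (ℕP.≮⇒≥ k≮v) (k≢v ∘ sym)))))

    Σterms≡-N*d : sum terms ≡ - (N * + d)
    Σterms≡-N*d = begin
      sum terms                                         ≡⟨ sum-cong-≗ (λ i → separate (does (k i ℕ.≟ v)) (c i) (+ s i)) ⟩
      sum (λ i → 1ℤ * (c i * + s i) + (- + d) * (if does (k i ℕ.≟ v) then c i else 0ℤ))
                                                        ≡⟨ sum-linear 1ℤ (- + d) (λ i → c i * + s i) _ ⟩
      1ℤ * sum (λ i → c i * + s i) + (- + d) * N        ≡⟨ cong (λ z → 1ℤ * z + (- + d) * N) Σcs≡0 ⟩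
      1ℤ * 0ℤ + (- + d) * N                             ≡⟨ collect N (+ d) ⟩
      - (N * + d)                                       ∎
      where
      collect : ∀ N D → 1ℤ * 0ℤ + (- D) * N ≡ - (N * D)
      collect = solve-∀
      separate : ∀ b c s → c * (s - (if b then + d else 0ℤ)) ≡ 1ℤ * (c * s) + (- + d) * (if b then c else 0ℤ)
      separate true  c s = atLevel c s (+ d)
        where
        atLevel : ∀ c s D → c * (s - D) ≡ 1ℤ * (c * s) + (- D) * c
        atLevel = solve-∀
      separate false c s = offLevel c s (+ d)
        where
        offLevel : ∀ c s D → c * (s - 0ℤ) ≡ 1ℤ * (c * s) + (- D) * 0ℤ
        offLevel = solve-∀

prime∤ : ∀ {p d} {N : ℤ} → Prime p → N ≢ 0ℤ → ∣ N ∣ < p → d ≢ 0 → d < p → ¬ (+ p ∣ N * + d)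
prime∤ {p} {d} {N} p-prime N≢0 ∣N∣<p d≢0 d<p (q , q*p≡N*d) =
  Sum.[ ℕ∣.>⇒∤ {{ℕ.≢-nonZero (N≢0 ∘ ℤP.∣i∣≡0⇒i≡0)}} ∣N∣<p , ℕ∣.>⇒∤ {{ℕ.≢-nonZero d≢0}} d<p ]
    (euclidsLemma ∣ N ∣ d p-prime (ℕ∣.divides ∣ q ∣ ∣N∣*d≡∣q∣*p))
  where
  ∣N∣*d≡∣q∣*p : ∣ N ∣ ℕ.* d ≡ ∣ q ∣ ℕ.* p
  ∣N∣*d≡∣q∣*p = begin
    ∣ N ∣ ℕ.* d   ≡⟨ ℤP.abs-* N (+ d) ⟨
    ∣ N * + d ∣   ≡⟨ cong ∣_∣ q*p≡N*d ⟨
    ∣ q * + p ∣   ≡⟨ ℤP.abs-* q (+ p) ⟩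
    ∣ q ∣ ℕ.* p   ∎

-- Rational spans and the columns condition

ι : ℤ → ℚ
ι z = z ℚ./ 1

-- z / 1 is already in lowest terms, so normalisation leaves it alone.
ι≡mkℚ : ∀ z → ι z ≡ mkℚ z 0 (Coprime.sym (1-coprimeTo ∣ z ∣))
ι≡mkℚ z = ℚP.↥p/↧p≡p (mkℚ z 0 (Coprime.sym (1-coprimeTo ∣ z ∣)))

ι-+ : ∀ a b → ι (a + b) ≡ ι a ℚ.+ ι b
ι-+ a b = trans (ℚP./-cong {p₁ = a + b} {q₁ = 1} {p₂ = a * + 1 + b * + 1} {q₂ = 1}
                            (sym (cong₂ _+_ (ℤP.*-identityʳ a) (ℤP.*-identityʳ b))) refl)
                (sym (cong₂ ℚ._+_ (ι≡mkℚ a) (ι≡mkℚ b)))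

ι-* : ∀ a b → ι (a * b) ≡ ι a ℚ.* ι b
ι-* a b = sym (cong₂ ℚ._*_ (ι≡mkℚ a) (ι≡mkℚ b))

ι≡0⇒≡0 : ∀ c → ι c ≡ 0ℚ → c ≡ 0ℤ
ι≡0⇒≡0 c ιc≡0 = cong ℚ.↥_ (trans (sym (ι≡mkℚ c)) ιc≡0)

∑-cong : ∀ {n} {f g : Fin n → ℚ} → (∀ i → f i ≡ g i) → ∑ f ≡ ∑ g
∑-cong {zero}  _   = refl
∑-cong {suc n} f≗g = cong₂ ℚ._+_ (f≗g zero) (∑-cong (f≗g ∘ suc))

∑-zero : ∀ n → ∑ {n} (λ _ → 0ℚ) ≡ 0ℚ
∑-zero zero    = refl
∑-zero (suc n) = trans (cong (0ℚ ℚ.+_) (∑-zero n)) (ℚP.+-identityˡ 0ℚ)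

∑-ι : ∀ {n} (f : Fin n → ℤ) → ∑ (λ i → ι (f i)) ≡ ι (sum f)
∑-ι {zero}  f = refl
∑-ι {suc n} f = trans (cong (ι (f zero) ℚ.+_) (∑-ι (f ∘ suc))) (sym (ι-+ (f zero) (sum (f ∘ suc))))

∑-*ˡ : ∀ {n} a (f : Fin n → ℚ) → ∑ (λ i → a ℚ.* f i) ≡ a ℚ.* ∑ f
∑-*ˡ {zero}  a f = sym (ℚP.*-zeroʳ a)
∑-*ˡ {suc n} a f = trans (cong (a ℚ.* f zero ℚ.+_) (∑-*ˡ a (f ∘ suc))) (sym (ℚP.*-distribˡ-+ a (f zero) (∑ (f ∘ suc))))

Spans : ∀ {n} {Row : Set} → (Row → Fin n → ℚ) → (E S : Fin n → Bool) → Set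
Spans {n} A E S = ∃ λ (λs : Fin n → ℚ) → ∀ x →
  ∑ (λ i → if S i then A x i else 0ℚ) ≡ ∑ (λ i → if E i then λs i ℚ.* A x i else 0ℚ)

spans-resp : ∀ {n} {Row : Set} (A : Row → Fin n → ℚ) {E E′ S S′ : Fin n → Bool} →
             (∀ i → E i ≡ E′ i) → (∀ i → S i ≡ S′ i) → Spans A E S → Spans A E′ S′
spans-resp A E≗E′ S≗S′ (λs , eq) = λs , λ x → begin
  ∑ (λ i → if _ then A x i else 0ℚ)            ≡⟨ ∑-cong (λ i → cong (λ b → if b then A x i else 0ℚ) (S≗S′ i)) ⟨
  ∑ (λ i → if _ then A x i else 0ℚ)            ≡⟨ eq x ⟩
  ∑ (λ i → if _ then λs i ℚ.* A x i else 0ℚ)   ≡⟨ ∑-cong (λ i → cong (λ b → if b then λs i ℚ.* A x i else 0ℚ) (E≗E′ i)) ⟩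
  ∑ (λ i → if _ then λs i ℚ.* A x i else 0ℚ)   ∎

below at : ∀ {n} → (Fin n → ℕ) → ℕ → Fin n → Bool
below g v i = does (g i ℕ.<? v)
at    g v i = does (g i ℕ.≟ v)

strict-bound : ∀ {n} (g : Fin n → ℕ) → ∃ λ w → ∀ i → g i < w
strict-bound {zero}  g = 0 , λ ()
strict-bound {suc n} g with strict-bound (g ∘ suc)
... | w , g<w = suc (g zero) ⊔ w , λ
  { zero    → m≤m⊔n (suc (g zero)) w
  ; (suc i) → ≤-trans (g<w i) (m≤n⊔m (suc (g zero)) w)
  }

module Rank {n} (g : Fin n → ℕ) where

  rank : ℕ → ℕ
  rank zero = 0
  rank (suc w) with any? (λ i → g i ℕ.≟ w)
  ... | yes _ = suc (rank w)
  ... | no _  = rank w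

  rank-step : ∀ w → rank w ≤ rank (suc w)
  rank-step w with any? (λ i → g i ℕ.≟ w)
  ... | yes _ = ℕP.n≤1+n (rank w)
  ... | no _  = ≤-refl

  rank-mono : ∀ {a b} → a ≤ b → rank a ≤ rank b
  rank-mono {a} {b} a≤b = subst (λ c → rank a ≤ rank c) (ℕP.m∸n+n≡m a≤b) (go (b ∸ a))
    where
    go : ∀ c → rank a ≤ rank (c ℕ.+ a)
    go zero    = ≤-refl
    go (suc c) = ≤-trans (go c) (rank-step (c ℕ.+ a))

  rank-< : ∀ i {w} → g i < w → rank (g i) < rank w
  rank-< i g<w with any? (λ l → g l ℕ.≟ g i) | rank-mono g<w
  ... | yes _   | le = le
  ... | no g∉im | _  = contradiction (i , refl) g∉im

  rank-onto : ∀ w {u} → u < rank w → ∃ λ i → rank (g i) ≡ u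
  rank-onto (suc w) {u} u<rank with any? (λ i → g i ℕ.≟ w)
  ... | no _ = rank-onto w u<rank
  ... | yes (i , gi≡w) with u ℕ.<? rank w
  ...   | yes u<rank′ = rank-onto w u<rank′
  ...   | no u≮rank′  = i , trans (cong rank gi≡w) (ℕP.≤-antisym (ℕP.≮⇒≥ u≮rank′) (ℕP.≤-pred u<rank))

rank-relabelling : ∀ {n} (g : Fin (suc n) → ℕ) → ∃₂ λ r (f : Fin (suc n) → Fin (suc r)) →
                   (∀ u → ∃ λ i → f i ≡ u) × (∀ i l → toℕ (f i) < toℕ (f l) ⇔ g i < g l)
rank-relabelling g = relabel (rank w) (λ i → rank-< i (g<w i)) (rank-onto w)
  where
  open Rank g
  w = proj₁ (strict-bound g)
  g<w = proj₂ (strict-bound g)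
  relabel : ∀ N → (rank<N : ∀ i → rank (g i) < N) → (∀ {u} → u < N → ∃ λ i → rank (g i) ≡ u) →
            ∃₂ λ r (f : Fin _ → Fin (suc r)) → (∀ u → ∃ λ i → f i ≡ u) × (∀ i l → toℕ (f i) < toℕ (f l) ⇔ g i < g l)
  relabel zero    rank<0 _    = contradiction (rank<0 zero) ℕP.n≮0
  relabel (suc r) rank<N onto = r , f , f-onto , λ i l → mk⇔ (from i l) (to i l)
    where
    f : Fin _ → Fin (suc r)
    f i = fromℕ< (rank<N i)
    f-onto : ∀ u → ∃ λ i → f i ≡ u
    f-onto u with onto (FinP.toℕ<n u)
    ... | i , rank≡u = i , toℕ-injective (trans (toℕ-fromℕ< (rank<N i)) rank≡u)
    to : ∀ i l → g i < g l → toℕ (f i) < toℕ (f l)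
    to i l gi<gl = subst₂ _<_ (sym (toℕ-fromℕ< (rank<N i))) (sym (toℕ-fromℕ< (rank<N l))) (rank-< i gi<gl)
    from : ∀ i l → toℕ (f i) < toℕ (f l) → g i < g l
    from i l fi<fl = ℕP.≰⇒> λ gl≤gi → ℕP.<⇒≱ fi<fl
      (subst₂ _≤_ (sym (toℕ-fromℕ< (rank<N l))) (sym (toℕ-fromℕ< (rank<N i))) (rank-mono gl≤gi))

same-<⇒same-≡ : ∀ {A : Set} (f g : A → ℕ) → (∀ a b → f a < f b ⇔ g a < g b) → ∀ a b → f a ≡ f b → g a ≡ g b
same-<⇒same-≡ f g same a b fa≡fb with ℕP.<-cmp (g a) (g b)
... | tri< ga<gb _ _ = contradiction (Equivalence.from (same a b) ga<gb) (ℕP.<-irrefl fa≡fb)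
... | tri≈ _ ga≡gb _ = ga≡gb
... | tri> _ _ gb<ga = contradiction (Equivalence.from (same b a) gb<ga) (ℕP.<-irrefl (sym fa≡fb))

columnsCondition-from-levels : ∀ {n} (Row : Set) (A : Row → Fin (suc n) → ℚ) (g : Fin (suc n) → ℕ) →
                               (∀ v → Spans A (below g v) (at g v)) → ColumnsCondition Row A
columnsCondition-from-levels {n} Row A g spans with rank-relabelling g
... | r , f , onto , same< = inj₂ (r , f , onto , bottom , λ u _ → level u)
  where
  same≡ : ∀ i l → f i ≡ f l ⇔ g i ≡ g l
  same≡ i l = mk⇔ (same-<⇒same-≡ (toℕ ∘ f) g same< i l ∘ cong toℕ)
                  (toℕ-injective ∘ same-<⇒same-≡ g (toℕ ∘ f) (λ a b → ⇔-sym (same< a b)) i l)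
  level : ∀ u → Spans A (λ i → does (f i FinP.<? u)) (λ i → does (f i FinP.≟ u))
  level u with onto u
  ... | i₀ , refl = spans-resp A {E = below g (g i₀)} {S = at g (g i₀)}
                      (λ i → does-⇔ (⇔-sym (same< i i₀)) (g i ℕ.<? g i₀) (f i FinP.<? f i₀))
                      (λ i → does-⇔ (⇔-sym (same≡ i i₀)) (g i ℕ.≟ g i₀) (f i FinP.≟ f i₀))
                      (spans (g i₀))
  bottom : ∀ x → ∑ (λ i → if does (f i FinP.≟ zero) then A x i else 0ℚ) ≡ 0ℚ
  bottom x with level zero
  ... | λs , eq = begin
    ∑ (λ i → if does (f i FinP.≟ zero) then A x i else 0ℚ)  ≡⟨ eq x ⟩
    ∑ (λ i → if does (f i FinP.<? Fin.zero {r}) then λs i ℚ.* A x i else 0ℚ)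
       ≡⟨ ∑-cong (λ i → cong (λ b → if b then λs i ℚ.* A x i else 0ℚ) (dec-false (f i FinP.<? Fin.zero {r}) (ℕP.n≮0 {toℕ (f i)}))) ⟩
    ∑ {suc n} (λ _ → 0ℚ)                                     ≡⟨ ∑-zero (suc n) ⟩
    0ℚ                                                       ∎

module Levels {K n} (A : Fin K → Fin n → ℤ) where

  column : Fin n → Fin K → ℤ
  column i x = A x i

  columnsIn : (Fin n → Bool) → Fin n → Fin K → ℤ
  columnsIn E i x = if E i then A x i else 0ℤ

  columnSum : (Fin n → Bool) → Fin K → ℤ
  columnSum S x = sum (λ i → if S i then A x i else 0ℤ)

  separation-bound : ∃ λ B → ∀ E S → InSpan (columnsIn E) (columnSum S) ⊎ SeparatedWithin B (columnsIn E) (columnSum S)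
  separation-bound with uniform-separation (columnsIn ∘ lookup) (columnSum ∘ lookup)
  ... | B , alternative = B , λ E S →
    Sum.map (inSpan-resp (columns≗ E) (sum≗ S)) (separatedWithin-resp (columns≗ E) (sum≗ S)) (alternative (tabulate E) (tabulate S))
    where
    columns≗ : ∀ E i x → columnsIn (lookup (tabulate E)) i x ≡ columnsIn E i x
    columns≗ E i x = cong (λ b → if b then A x i else 0ℤ) (lookup∘tabulate E i)
    sum≗ : ∀ S x → columnSum (lookup (tabulate S)) x ≡ columnSum S x
    sum≗ S x = sum-cong-≗ (λ i → columns≗ S i x)

  inSpan⇒spans : ∀ {E S} → InSpan (columnsIn E) (columnSum S) → Spans (λ x i → ι (A x i)) E S
  inSpan⇒spans {E} {S} (c , μ , c≢0 , eq) = (λ j → c⁻¹ ℚ.* ι (μ j)) , λ x → begin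
    ∑ (λ i → if S i then ι (A x i) else 0ℚ)                 ≡⟨ ∑-cong (λ i → ι-if (S i) (A x i)) ⟩
    ∑ (λ i → ι (if S i then A x i else 0ℤ))                 ≡⟨ ∑-ι (λ i → if S i then A x i else 0ℤ) ⟩
    ι (columnSum S x)                                       ≡⟨ cancel (columnSum S x) ⟨
    c⁻¹ ℚ.* ι (c * columnSum S x)                           ≡⟨ cong (λ z → c⁻¹ ℚ.* ι z) (eq x) ⟩
    c⁻¹ ℚ.* ι (sum (λ j → μ j * columnsIn E j x))           ≡⟨ cong (c⁻¹ ℚ.*_) (∑-ι (λ j → μ j * columnsIn E j x)) ⟨
    c⁻¹ ℚ.* ∑ (λ j → ι (μ j * columnsIn E j x))             ≡⟨ ∑-*ˡ c⁻¹ (λ j → ι (μ j * columnsIn E j x)) ⟨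
    ∑ (λ j → c⁻¹ ℚ.* ι (μ j * columnsIn E j x))             ≡⟨ ∑-cong (λ j → reassociate (E j) (μ j) (A x j)) ⟩
    ∑ (λ j → if E j then (c⁻¹ ℚ.* ι (μ j)) ℚ.* ι (A x j) else 0ℚ) ∎
    where
    instance
      ιc≢0 : ℚ.NonZero (ι c)
      ιc≢0 = ℚ.≢-nonZero (c≢0 ∘ ι≡0⇒≡0 c)
    c⁻¹ : ℚ
    c⁻¹ = ℚ.1/ ι c
    ι-if : ∀ b a → (if b then ι a else 0ℚ) ≡ ι (if b then a else 0ℤ)
    ι-if true  a = refl
    ι-if false a = refl
    cancel : ∀ a → c⁻¹ ℚ.* ι (c * a) ≡ ι a
    cancel a = begin
      c⁻¹ ℚ.* ι (c * a)       ≡⟨ cong (c⁻¹ ℚ.*_) (ι-* c a) ⟩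
      c⁻¹ ℚ.* (ι c ℚ.* ι a)   ≡⟨ ℚP.*-assoc c⁻¹ (ι c) (ι a) ⟨
      c⁻¹ ℚ.* ι c ℚ.* ι a     ≡⟨ cong (ℚ._* ι a) (ℚP.*-inverseˡ (ι c)) ⟩
      ℚ.1ℚ ℚ.* ι a            ≡⟨ ℚP.*-identityˡ (ι a) ⟩
      ι a                     ∎
    reassociate : ∀ b m a → c⁻¹ ℚ.* ι (m * (if b then a else 0ℤ)) ≡ (if b then (c⁻¹ ℚ.* ι m) ℚ.* ι a else 0ℚ)
    reassociate true  m a = trans (cong (c⁻¹ ℚ.*_) (ι-* m a)) (sym (ℚP.*-assoc c⁻¹ (ι m) (ι a)))
    reassociate false m a = trans (cong (λ z → c⁻¹ ℚ.* ι z) (ℤP.*-zeroʳ m)) (ℚP.*-zeroʳ c⁻¹)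

  module _ (p : ℕ) .{{_ : NonZero p}} (p-prime : Prime p) {B} (B<p : B < p)
           (k q : Fin n → ℕ) {d} (d≢0 : d ≢ 0) (d<p : d < p) (q%p≡d : ∀ i → q i % p ≡ d)
           (solution : ∀ x → sum (λ i → A x i * + (p ^ k i ℕ.* q i)) ≡ 0ℤ) where

    not-separated : ∀ v → ¬ SeparatedWithin B (columnsIn (below k v)) (columnSum (at k v))
    not-separated v (W , orth , N≢0 , ∣N∣≤B) =
      prime∤ p-prime N≢0 (ℕP.≤-<-trans ∣N∣≤B B<p) d≢0 d<p (subst (λ N → + p ∣ N * + d) levelSum≡N p∣levelSum*d)
      where
      c : Fin n → ℤ
      c i = dot W (column i)
      c-below : ∀ l → k l < v → c l ≡ 0ℤ
      c-below l k<v = trans (dot-congʳ W (λ x → cong (λ b → if b then A x l else 0ℤ) (sym (dec-true (k l ℕ.<? v) k<v)))) (orth l)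
      Σct≡0 : sum (λ i → c i * + (p ^ k i ℕ.* q i)) ≡ 0ℤ
      Σct≡0 = trans (dot-mat W A (λ i → + (p ^ k i ℕ.* q i)))
                    (sum-zero _ (λ x → trans (cong (W x *_) (solution x)) (ℤP.*-zeroʳ (W x))))
      p∣levelSum*d : + p ∣ sum (λ i → if at k v i then c i else 0ℤ) * + d
      p∣levelSum*d = level-divisible p k q d v c q%p≡d c-below Σct≡0
      levelSum≡N : sum (λ i → if at k v i then c i else 0ℤ) ≡ dot W (columnSum (at k v))
      levelSum≡N = begin
        sum (λ i → if at k v i then c i else 0ℤ)                           ≡⟨ sum-cong-≗ (λ i → masked (at k v i) (c i)) ⟨
        sum (λ i → c i * (if at k v i then 1ℤ else 0ℤ))                    ≡⟨ dot-mat W A (λ i → if at k v i then 1ℤ else 0ℤ) ⟩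
        dot W (λ x → sum (λ i → A x i * (if at k v i then 1ℤ else 0ℤ)))    ≡⟨ dot-congʳ W (λ x → sum-cong-≗ (λ i → masked (at k v i) (A x i))) ⟩
        dot W (columnSum (at k v))                                          ∎

  levels-spanned : ∃ λ B → ∀ p .{{_ : NonZero p}} → Prime p → B < p →
                   ∀ (k q : Fin n → ℕ) {d} → d ≢ 0 → d < p → (∀ i → q i % p ≡ d) →
                   (∀ x → sum (λ i → A x i * + (p ^ k i ℕ.* q i)) ≡ 0ℤ) →
                   ∀ v → Spans (λ x i → ι (A x i)) (below k v) (at k v)
  levels-spanned =
    let B , alternative = separation-bound
    in B , λ p p-prime B<p k q d≢0 d<p q%p≡d solution v →
      Sum.[ inSpan⇒spans {below k v} {at k v} , ⊥-elim ∘ not-separated p p-prime B<p k q d≢0 d<p q%p≡d solution v ]′ (alternative (below k v) (at k v))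

columnsCondition-from-solutions :
  ∀ {K n} (Row : Set) (row : Row → Fin K) (A : Fin K → Fin (suc n) → ℤ) →
  (∀ p .{{_ : NonZero p}} → Prime p → ∃₂ λ (k q : Fin (suc n) → ℕ) → ∃ λ d → d ≢ 0 × (∀ i → q i % p ≡ d) ×
     (∀ x → sum (λ i → A x i * + (p ^ k i ℕ.* q i)) ≡ 0ℤ)) →
  ColumnsCondition Row (λ x i → ι (A (row x) i))
columnsCondition-from-solutions Row row A solutions =
  let B , spanned = Levels.levels-spanned A
      p , p-prime , B<p = prime> B
      instance′ = prime⇒nonZero p-prime
      k , q , d , d≢0 , q%p≡d , solution = solutions p {{instance′}} p-prime
      d<p = subst (_< p) (q%p≡d zero) (m%n<n (q zero) p {{instance′}})
  in columnsCondition-from-levels Row (λ x i → ι (A (row x) i)) k λ v →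
       restrict {below k v} {at k v} (spanned p {{instance′}} p-prime B<p k q d≢0 d<p q%p≡d solution v)
  where
  restrict : ∀ {E S} → Spans (λ x i → ι (A x i)) E S → Spans (λ x i → ι (A (row x) i)) E S
  restrict (λs , eq) = λs , eq ∘ row

-- Rado sets

radoSet-solution : ∀ {c ℓ} {R : CommutativeRing c ℓ} {n} {P : Poly R n} {J} → RadoSet R n P J →
                   ∀ m (col : ℕ → Fin m) →
                   ∃ λ t → Positive t × Monochromatic col t × (∀ {α β} → α ∈ J → β ∈ J → (α · t) ≡ (β · t))
radoSet-solution {P = P} {J} (blocks , (_ , concat↭supp , rado) , J∈blocks) m col with rado m col []
... | t , _ , positive , mono , fibres = t , positive , mono , λ α∈J β∈J →
  Equivalence.from (fibres _ _ (inSupp α∈J) (inSupp β∈J)) (Any.map (λ { refl → α∈J , β∈J }) J∈blocks)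
  where
  inSupp : ∀ {α} → α ∈ J → α ∈ supp P
  inSupp α∈J = ∈-resp-↭ concat↭supp (∈-concat⁺′ α∈J J∈blocks)

-- The infinitely many solutions demanded of a Rado partition cannot live in ℕ⁰.
radoSet-dim≢0 : ∀ {c ℓ} {R : CommutativeRing c ℓ} {P : Poly R 0} {J} → ¬ RadoSet R 0 P J
radoSet-dim≢0 (_ , (_ , _ , rado) , _) with rado 1 (λ _ → zero) ([] ∷ [])
... | [] , []∉[[]] , _ = []∉[[]] (here refl)

radoSet-pAdic-solution :
  ∀ {c ℓ} {R : CommutativeRing c ℓ} {n} {P : Poly R (suc n)} {J} → RadoSet R (suc n) P J →
  ∀ p .{{_ : NonZero p}} → Prime p → ∃₂ λ (k q : Fin (suc n) → ℕ) → ∃ λ d → d ≢ 0 × (∀ i → q i % p ≡ d) ×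
    ∃ λ t → (∀ i → lookup t i ≡ p ^ k i ℕ.* q i) × (∀ {α β} → α ∈ J → β ∈ J → (α · t) ≡ (β · t))
radoSet-pAdic-solution {R = R} {P = P} {J} radoSet p p-prime =
  let t , positive , monochromatic , sameDot = radoSet-solution {R = R} {P = P} {J} radoSet p (λ x → unitPart x mod p)
      q = unitPart ∘ lookup t
      factorisation : ∀ i → lookup t i ≡ p ^ valuation (lookup t i) ℕ.* q i × q i % p ≢ 0
      factorisation i = unitPart-spec (lookup t i) (positive i)
      sameResidue : ∀ i → q i % p ≡ q zero % p
      sameResidue i = trans (sym (toℕ-fromℕ< (m%n<n (q i) p)))
                            (trans (cong toℕ (monochromatic i zero)) (toℕ-fromℕ< (m%n<n (q zero) p)))
  in valuation ∘ lookup t , q , q zero % p , proj₂ (factorisation zero) , sameResidue , t , proj₁ ∘ factorisation , sameDot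
  where open PAdic p (nonTrivial⇒n>1 p {{prime⇒nonTrivial p-prime}})

dot-pos : ∀ {n} (α t : Vec ℕ n) → sum (λ i → + lookup α i * + lookup t i) ≡ + (α · t)
dot-pos []      []      = refl
dot-pos (a ∷ α) (x ∷ t) = trans (cong₂ _+_ (sym (ℤP.pos-* a x)) (dot-pos α t)) (sym (ℤP.pos-+ (a ℕ.* x) (α · t)))

difference-solution : ∀ {n} (α β t : Vec ℕ n) → (α · t) ≡ (β · t) →
                      sum (λ i → (+ lookup α i - + lookup β i) * + lookup t i) ≡ 0ℤ
difference-solution α β t α·t≡β·t = begin
  sum (λ i → (+ lookup α i - + lookup β i) * + lookup t i)
    ≡⟨ sum-cong-≗ (λ i → separate (+ lookup α i) (+ lookup β i) (+ lookup t i)) ⟩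
  sum (λ i → 1ℤ * (+ lookup α i * + lookup t i) + (- 1ℤ) * (+ lookup β i * + lookup t i))
    ≡⟨ sum-linear 1ℤ (- 1ℤ) (λ i → + lookup α i * + lookup t i) (λ i → + lookup β i * + lookup t i) ⟩
  1ℤ * sum (λ i → + lookup α i * + lookup t i) + (- 1ℤ) * sum (λ i → + lookup β i * + lookup t i)
    ≡⟨ cong₂ (λ a b → 1ℤ * a + (- 1ℤ) * b) (dot-pos α t) (trans (dot-pos β t) (cong +_ (sym α·t≡β·t))) ⟩
  1ℤ * + (α · t) + (- 1ℤ) * + (α · t)
    ≡⟨ cancel (+ (α · t)) ⟩
  0ℤ ∎
  where
  separate : ∀ a b t → (a - b) * t ≡ 1ℤ * (a * t) + (- 1ℤ) * (b * t)
  separate = solve-∀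
  cancel : ∀ a → 1ℤ * a + (- 1ℤ) * a ≡ 0ℤ
  cancel = solve-∀

lemma2p3 : ∀ {c ℓ} (R : CommutativeRing c ℓ) (n : ℕ) (P : Poly R n)
             (J : List (Vec ℕ n)) → RadoSet R n P J →
             (j : Fin (length J)) →
             ColumnsCondition (Σ (Fin (length J)) (λ i → i ≢ j)) (Mat J j)
lemma2p3 R zero    P J radoSet j = ⊥-elim (radoSet-dim≢0 {R = R} {P} {J} radoSet)
lemma2p3 R (suc n) P J radoSet j = columnsCondition-from-solutions _ proj₁ A solutions
  where
  α : Fin (length J) → Vec ℕ (suc n)
  α = L.lookup J
  A : Fin (length J) → Fin (suc n) → ℤ
  A x i = + lookup (α x) i - + lookup (α j) i
  solutions : ∀ p .{{_ : NonZero p}} → Prime p → ∃₂ λ (k q : Fin (suc n) → ℕ) → ∃ λ d → d ≢ 0 ×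
              (∀ i → q i % p ≡ d) × (∀ x → sum (λ i → A x i * + (p ^ k i ℕ.* q i)) ≡ 0ℤ)
  solutions p p-prime with radoSet-pAdic-solution {R = R} {P = P} {J} radoSet p p-prime
  ... | k , q , d , d≢0 , q%p≡d , t , t≡p^k*q , sameDot = k , q , d , d≢0 , q%p≡d , λ x →
    trans (sum-cong-≗ (λ i → cong (λ z → A x i * + z) (sym (t≡p^k*q i))))
          (difference-solution (α x) (α j) t (sameDot (∈-lookup x) (∈-lookup j)))
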